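{- Let $n\in\mathbb{N}$ and let $I\subseteq[n]$, $\overline J\subseteq[\overline n]$ be subsets with $|I|=|\overline J|$. Then there exists a unique perfect matching of the complete bipartite graph $K_{I,\overline J}$ no two of whose arcs cyclically cross.
   Context: $[n]=\{0,\dots,n\}$, $[\overline n]=\{\overline 0,\dots,\overline n\}$. All differences are modulo $n+1$ with representatives in $\{0,\dots,n\}$. Arcs $(i,\overline j),(i',\overline{j'})$ cyclically cross if either ($j-i'<j-i$ and $j-i'<j'-i'$) or ($j'-i<j-i$ and $j'-i<j'-i'$). -}

module Defs where

open import Data.Nat using (ℕ; suc; _+_; _∸_; _<_)
open import Data.Nat.DivMod using (_%_)
open import Data.Fin using (Fin; toℕ)
open import Data.Fin.Subset using (Subset; _∈_)
open import Data.Bool using (Bool; true)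
open import Data.Product using (Σ; _×_; ∃-syntax)
open import Data.Sum using (_⊎_)
open import Relation.Nullary using (¬_)
open import Relation.Binary.PropositionalEquality using (_≡_)

-- Vertices of [n] = {0,…,n} and of [n̄] are both indexed by Fin (suc n).
-- diff n a b = (a - b) mod (n+1), representative in {0,…,n}.
diff : (n : ℕ) → Fin (suc n) → Fin (suc n) → ℕ
diff n a b = (toℕ a + suc n ∸ toℕ b) % suc n

CyclicallyCross : (n : ℕ) → (i j i' j' : Fin (suc n)) → Set
CyclicallyCross n i j i' j' =
  (diff n j i' < diff n j i × diff n j i' < diff n j' i')
  ⊎ (diff n j' i < diff n j i × diff n j' i < diff n j' i')

-- A set of arcs between [n] and [n̄]: M i j ≡ true means (i, j̄) is an arc.
Arcs : ℕ → Set
Arcs n = Fin (suc n) → Fin (suc n) → Bool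

IsPerfectMatching : (n : ℕ) → Subset (suc n) → Subset (suc n) → Arcs n → Set
IsPerfectMatching n I J M =
  (∀ i j → M i j ≡ true → (i ∈ I) × (j ∈ J))
  × (∀ i → i ∈ I → ∃[ j ] (M i j ≡ true × (∀ j' → M i j' ≡ true → j' ≡ j)))
  × (∀ j → j ∈ J → ∃[ i ] (M i j ≡ true × (∀ i' → M i' j ≡ true → i' ≡ i)))

-- No two arcs of M cyclically cross (an arc never crosses itself).
NonCrossing : (n : ℕ) → Arcs n → Set
NonCrossing n M =
  ∀ i j i' j' → M i j ≡ true → M i' j' ≡ true → ¬ CyclicallyCross n i j i' j'

-- Among the pairs (a, b̄) ∈ I × J̄ choose one whose cyclic distance b − a is least. By
-- minimality no arc of K_{I,J̄} crosses (a, b̄), so adding it to the non-crossing matching of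
-- (I ∖ a, J̄ ∖ b̄) gives one of (I, J̄). Conversely, in any non-crossing perfect matching a and
-- b̄ are matched together: were a matched to j̄ ≠ b̄ and i ≠ a to b̄, strict minimality would make
-- (a, j̄) and (i, b̄) cross. Deleting (a, b̄) then reduces uniqueness to (I ∖ a, J̄ ∖ b̄).
module Submission where

open import Defs
open import Data.Nat using (ℕ; zero; suc; _+_; _∸_; _<_; _≤_; NonZero)
open import Data.Nat.Properties
  using (+-comm; +-assoc; m∸n+n≡m; <⇒≤; <⇒≱; ≤-trans; m≤n+m; ≤∧≢⇒<; ≮⇒≥; <-irrefl; n≮0; suc-injective)
  renaming (_≟_ to _≟ℕ_)
open import Data.Nat.DivMod using (_%_; %-distribˡ-+; m%n%n≡m%n; [m+n]%n≡m%n; m<n⇒m%n≡m; m%n<n)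
open import Data.Nat.Induction using (<-rec)
open import Data.Fin using (Fin; toℕ; fromℕ<)
open import Data.Fin.Properties using (toℕ-injective; toℕ<n; toℕ-fromℕ<; any?; _≟_)
open import Data.Fin.Subset using (Subset; ∣_∣; _∈_; _∉_; _-_; _─_; ⁅_⁆; Nonempty; Empty; inside; outside)
open import Data.Fin.Subset.Properties
  using (_∈?_; x∈p∧x≢y⇒x∈p-y; x∈p⇒∣p-x∣<∣p∣; p─q⊆p; p─⊥≡p; x∉⁅y⁆⇒x≢y; nonempty?; Empty-unique; ∣⊥∣≡0)
open import Data.Vec using (_∷_; here; there)
open import Data.Bool using (Bool; true; false)
open import Data.Product using (Σ; _×_; _,_; proj₁; proj₂; ∃-syntax; ∃₂)
open import Data.Product.Properties using (≡-dec)
open import Data.Sum using (_⊎_; inj₁; inj₂)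
open import Function using (_∘_)
open import Relation.Nullary using (¬_; Dec; yes; no; contradiction)
open import Relation.Nullary.Decidable using (_×-dec_)
open import Relation.Unary using (Pred; Decidable)
open import Relation.Binary.PropositionalEquality using (_≡_; _≢_; refl; sym; trans; cong; subst)
open Relation.Binary.PropositionalEquality.≡-Reasoning

x∈p─q⇒x∉q : ∀ {m} {p q : Subset m} {x} → x ∈ p ─ q → x ∉ q
x∈p─q⇒x∉q {p = _ ∷ _} {outside ∷ _} here      ()
x∈p─q⇒x∉q {p = _ ∷ _} {_ ∷ _}       (there h) (there h′) = x∈p─q⇒x∉q h h′

x∈p-y⇒x≢y : ∀ {m} {p : Subset m} {x y} → x ∈ p - y → x ≢ y
x∈p-y⇒x≢y = x∉⁅y⁆⇒x≢y ∘ x∈p─q⇒x∉q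

x∈p-y⇒x∈p : ∀ {m} {p : Subset m} {x y} → x ∈ p - y → x ∈ p
x∈p-y⇒x∈p {p = p} {y = y} = p─q⊆p p ⁅ y ⁆

x∈p⇒∣p-x∣+1≡∣p∣ : ∀ {m} {p : Subset m} {x} → x ∈ p → suc ∣ p - x ∣ ≡ ∣ p ∣
x∈p⇒∣p-x∣+1≡∣p∣ {p = inside ∷ p} here = cong (suc ∘ ∣_∣) (p─⊥≡p p)
x∈p⇒∣p-x∣+1≡∣p∣ {p = inside  ∷ _} (there h) = cong suc (x∈p⇒∣p-x∣+1≡∣p∣ h)
x∈p⇒∣p-x∣+1≡∣p∣ {p = outside ∷ _} (there h) = x∈p⇒∣p-x∣+1≡∣p∣ h

∣p∣≡0⇒Empty : ∀ {m} {p : Subset m} → ∣ p ∣ ≡ 0 → Empty p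
∣p∣≡0⇒Empty {p = p} ∣p∣≡0 (x , x∈p) = n≮0 (subst (∣ p - x ∣ <_) ∣p∣≡0 (x∈p⇒∣p-x∣<∣p∣ x∈p))

∣p∣≡suc⇒Nonempty : ∀ {m} {p : Subset m} {k} → ∣ p ∣ ≡ suc k → Nonempty p
∣p∣≡suc⇒Nonempty {m} {p} ∣p∣≡1+k with nonempty? p
... | yes ne = ne
... | no ¬ne with () ← trans (sym (∣⊥∣≡0 m)) (trans (cong ∣_∣ (sym (Empty-unique ¬ne))) ∣p∣≡1+k)

least-witness : ∀ {p} {P : Pred ℕ p} → Decidable P →
                ∀ {m} → P m → ∃[ k ] (P k × ∀ {l} → P l → k ≤ l)
least-witness {P = P} P? {m} = <-rec (λ m → P m → Least) search m
  where
  Least = ∃[ k ] (P k × ∀ {l} → P l → k ≤ l)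
  search : ∀ m → (∀ {l} → l < m → P l → Least) → P m → Least
  search m rec Pm with any? (λ (l : Fin m) → P? (toℕ l))
  ... | yes (l , Pl) = rec (toℕ<n l) Pl
  ... | no ¬smaller = m , Pm , λ {l} Pl → ≮⇒≥ λ l<m →
          ¬smaller (fromℕ< l<m , subst P (sym (toℕ-fromℕ< l<m)) Pl)

[m%d+n]%d≡[m+n]%d : ∀ m n d .{{_ : NonZero d}} → (m % d + n) % d ≡ (m + n) % d
[m%d+n]%d≡[m+n]%d m n d = begin
  (m % d + n) % d           ≡⟨ %-distribˡ-+ (m % d) n d ⟩
  (m % d % d + n % d) % d   ≡⟨ cong (λ r → (r + n % d) % d) (m%n%n≡m%n m d) ⟩
  (m % d + n % d) % d       ≡⟨ %-distribˡ-+ m n d ⟨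
  (m + n) % d               ∎

[m+n%d]%d≡[m+n]%d : ∀ m n d .{{_ : NonZero d}} → (m + n % d) % d ≡ (m + n) % d
[m+n%d]%d≡[m+n]%d m n d = begin
  (m + n % d) % d   ≡⟨ cong (_% d) (+-comm m (n % d)) ⟩
  (n % d + m) % d   ≡⟨ [m%d+n]%d≡[m+n]%d n m d ⟩
  (n + m) % d       ≡⟨ cong (_% d) (+-comm n m) ⟩
  (m + n) % d       ∎

[k+m]%d≡[k+n]%d⇒m%d≡n%d : ∀ k {m n} d .{{_ : NonZero d}} → (k + m) % d ≡ (k + n) % d → m % d ≡ n % d
[k+m]%d≡[k+n]%d⇒m%d≡n%d k {m} {n} d eq = begin
  m % d                   ≡⟨ undo m ⟨
  (d ∸ r + (k + m) % d) % d ≡⟨ cong (λ s → (d ∸ r + s) % d) eq ⟩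
  (d ∸ r + (k + n) % d) % d ≡⟨ undo n ⟩
  n % d                   ∎
  where
  r = k % d
  undo : ∀ x → (d ∸ r + (k + x) % d) % d ≡ x % d
  undo x = begin
    (d ∸ r + (k + x) % d) % d ≡⟨ cong (λ s → (d ∸ r + s) % d) ([m%d+n]%d≡[m+n]%d k x d) ⟨
    (d ∸ r + (r + x) % d) % d ≡⟨ [m+n%d]%d≡[m+n]%d (d ∸ r) (r + x) d ⟩
    (d ∸ r + (r + x)) % d     ≡⟨ cong (_% d) (+-assoc (d ∸ r) r x) ⟨
    (d ∸ r + r + x) % d       ≡⟨ cong (λ s → (s + x) % d) (m∸n+n≡m (<⇒≤ (m%n<n k d))) ⟩
    (d + x) % d               ≡⟨ cong (_% d) (+-comm d x) ⟩
    (x + d) % d               ≡⟨ [m+n]%n≡m%n x d ⟩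
    x % d                     ∎

module _ {n : ℕ} where

  private
    N = suc n

  [diff[x,a]+a]%N≡x : ∀ (x a : Fin N) → (diff n x a + toℕ a) % N ≡ toℕ x
  [diff[x,a]+a]%N≡x x a = begin
    ((toℕ x + N ∸ toℕ a) % N + toℕ a) % N ≡⟨ [m%d+n]%d≡[m+n]%d (toℕ x + N ∸ toℕ a) (toℕ a) N ⟩
    (toℕ x + N ∸ toℕ a + toℕ a) % N       ≡⟨ cong (_% N) (m∸n+n≡m (≤-trans (<⇒≤ (toℕ<n a)) (m≤n+m N (toℕ x)))) ⟩
    (toℕ x + N) % N                       ≡⟨ [m+n]%n≡m%n (toℕ x) N ⟩
    toℕ x % N                             ≡⟨ m<n⇒m%n≡m (toℕ<n x) ⟩
    toℕ x                                 ∎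

  diff-injectiveˡ : ∀ (a : Fin N) {x y} → diff n x a ≡ diff n y a → x ≡ y
  diff-injectiveˡ a {x} {y} eq = toℕ-injective (begin
    toℕ x                        ≡⟨ [diff[x,a]+a]%N≡x x a ⟨
    (diff n x a + toℕ a) % N     ≡⟨ cong (λ d → (d + toℕ a) % N) eq ⟩
    (diff n y a + toℕ a) % N     ≡⟨ [diff[x,a]+a]%N≡x y a ⟩
    toℕ y                        ∎)

  diff-injectiveʳ : ∀ (x : Fin N) {a b} → diff n x a ≡ diff n x b → a ≡ b
  diff-injectiveʳ x {a} {b} eq = toℕ-injective (begin
    toℕ a      ≡⟨ m<n⇒m%n≡m (toℕ<n a) ⟨
    toℕ a % N  ≡⟨ [k+m]%d≡[k+n]%d⇒m%d≡n%d (diff n x a) N (trans ([diff[x,a]+a]%N≡x x a) (sym shifted)) ⟩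
    toℕ b % N  ≡⟨ m<n⇒m%n≡m (toℕ<n b) ⟩
    toℕ b      ∎)
    where
    shifted : (diff n x a + toℕ b) % N ≡ toℕ x
    shifted = subst (λ d → (d + toℕ b) % N ≡ toℕ x) (sym eq) ([diff[x,a]+a]%N≡x x b)

  CyclicallyCross-sym : ∀ {i j i′ j′ : Fin N} → CyclicallyCross n i j i′ j′ → CyclicallyCross n i′ j′ i j
  CyclicallyCross-sym (inj₁ (p , q)) = inj₂ (q , p)
  CyclicallyCross-sym (inj₂ (p , q)) = inj₁ (q , p)

  ¬CyclicallyCross-refl : ∀ {i j : Fin N} → ¬ CyclicallyCross n i j i j
  ¬CyclicallyCross-refl (inj₁ (p , _)) = <-irrefl refl p
  ¬CyclicallyCross-refl (inj₂ (p , _)) = <-irrefl refl p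

  IsMinimalArc : Subset N → Subset N → Fin N → Fin N → Set
  IsMinimalArc I J a b = a ∈ I × b ∈ J × (∀ {i j} → i ∈ I → j ∈ J → diff n b a ≤ diff n j i)

  HasArcOfLength : Subset N → Subset N → ℕ → Set
  HasArcOfLength I J d = ∃₂ λ i j → i ∈ I × j ∈ J × diff n j i ≡ d

  hasArcOfLength? : ∀ I J → Decidable (HasArcOfLength I J)
  hasArcOfLength? I J d = any? λ i → any? λ j → (i ∈? I) ×-dec (j ∈? J) ×-dec (diff n j i ≟ℕ d)

  minimalArc : (I J : Subset N) → Nonempty I → Nonempty J → ∃₂ (IsMinimalArc I J)
  minimalArc I J (a , a∈I) (b , b∈J) with least-witness (hasArcOfLength? I J) (a , b , a∈I , b∈J , refl)
  ... | _ , (a′ , b′ , a′∈I , b′∈J , refl) , least =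
    a′ , b′ , a′∈I , b′∈J , λ i∈I j∈J → least (_ , _ , i∈I , j∈J , refl)

  minimalArc-noCrossing : ∀ {I J} {a b i j : Fin N} → IsMinimalArc I J a b →
                          i ∈ I → j ∈ J → ¬ CyclicallyCross n a b i j
  minimalArc-noCrossing (_ , b∈J , minimal) i∈I j∈J (inj₁ (b-i<b-a , _)) = <⇒≱ b-i<b-a (minimal i∈I b∈J)
  minimalArc-noCrossing (a∈I , _ , minimal) i∈I j∈J (inj₂ (j-a<b-a , _)) = <⇒≱ j-a<b-a (minimal a∈I j∈J)

  minimalArc-matched : ∀ {I J M} {a b : Fin N} → IsMinimalArc I J a b →
                       IsPerfectMatching n I J M → NonCrossing n M → M a b ≡ true
  minimalArc-matched {a = a} {b} (a∈I , b∈J , minimal) (inIJ , matchI , matchJ) nc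
    with matchI a a∈I | matchJ b b∈J
  ... | j , Maj , _ | i , Mib , _ with j ≟ b | i ≟ a
  ...   | yes refl | _        = Maj
  ...   | no _     | yes refl = Mib
  ...   | no j≢b   | no i≢a   = contradiction (inj₂ (b-a<j-a , b-a<b-i)) (nc a j i b Maj Mib)
    where
    b-a<j-a : diff n b a < diff n j a
    b-a<j-a = ≤∧≢⇒< (minimal a∈I (proj₂ (inIJ a j Maj))) (j≢b ∘ sym ∘ diff-injectiveˡ a)
    b-a<b-i : diff n b a < diff n b i
    b-a<b-i = ≤∧≢⇒< (minimal (proj₁ (inIJ i b Mib)) b∈J) (i≢a ∘ sym ∘ diff-injectiveʳ b)

  private
    _≟ᵃ_ : (x y : Fin N × Fin N) → Dec (x ≡ y)
    _≟ᵃ_ = ≡-dec _≟_ _≟_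

  setArc : Fin N → Fin N → Bool → Arcs n → Arcs n
  setArc a b v M i j with (i , j) ≟ᵃ (a , b)
  ... | yes _ = v
  ... | no  _ = M i j

  setArc-hit : ∀ a b v M → setArc a b v M a b ≡ v
  setArc-hit a b v M with (a , b) ≟ᵃ (a , b)
  ... | yes _ = refl
  ... | no ab≢ab = contradiction refl ab≢ab

  setArc-miss : ∀ {a b i j} v M → (i , j) ≢ (a , b) → setArc a b v M i j ≡ M i j
  setArc-miss {a} {b} {i} {j} v M ij≢ab with (i , j) ≟ᵃ (a , b)
  ... | yes ij≡ab = contradiction ij≡ab ij≢ab
  ... | no  _     = refl

  setArc-unique : ∀ {a b : Fin N} {v} {M M′ : Arcs n} → M′ a b ≡ v →
                  (∀ {i j} → (i , j) ≢ (a , b) → M′ i j ≡ M i j) →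
                  ∀ i j → M′ i j ≡ setArc a b v M i j
  setArc-unique {a} {b} M′ab≡v elsewhere i j with (i , j) ≟ᵃ (a , b)
  ... | yes refl   = M′ab≡v
  ... | no ij≢ab   = elsewhere ij≢ab

  setArc-true⇒ : ∀ a b M i j → setArc a b true M i j ≡ true → (i , j) ≡ (a , b) ⊎ M i j ≡ true
  setArc-true⇒ a b M i j h with (i , j) ≟ᵃ (a , b)
  ... | yes ij≡ab = inj₁ ij≡ab
  ... | no  _     = inj₂ h

  setArc-false⇒ : ∀ a b M i j → setArc a b false M i j ≡ true → (i , j) ≢ (a , b) × M i j ≡ true
  setArc-false⇒ a b M i j h with (i , j) ≟ᵃ (a , b)
  ... | no ij≢ab = ij≢ab , h

  module _ {I J : Subset N} {M : Arcs n} (pm : IsPerfectMatching n I J M) where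

    perfectMatching-functional : ∀ {i j j′} → M i j ≡ true → M i j′ ≡ true → j ≡ j′
    perfectMatching-functional {i} Mij Mij′ with proj₁ (proj₂ pm) i (proj₁ (proj₁ pm i _ Mij))
    ... | _ , _ , unique = trans (unique _ Mij) (sym (unique _ Mij′))

    perfectMatching-injective : ∀ {i i′ j} → M i j ≡ true → M i′ j ≡ true → i ≡ i′
    perfectMatching-injective {j = j} Mij Mi′j with proj₂ (proj₂ pm) j (proj₂ (proj₁ pm _ j Mij))
    ... | _ , _ , unique = trans (unique _ Mij) (sym (unique _ Mi′j))

  insertArc-perfect : ∀ {I J M} {a b : Fin N} → a ∈ I → b ∈ J →
                      IsPerfectMatching n (I - a) (J - b) M → IsPerfectMatching n I J (setArc a b true M)
  insertArc-perfect {I} {J} {M} {a} {b} a∈I b∈J (inIJ , matchI , matchJ) = arcs , rows , cols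
    where
    M⁺ = setArc a b true M

    new-or-old : ∀ i j → M⁺ i j ≡ true → (i , j) ≡ (a , b) ⊎ (i ≢ a × j ≢ b × M i j ≡ true)
    new-or-old i j h with setArc-true⇒ a b M i j h
    ... | inj₁ ij≡ab = inj₁ ij≡ab
    ... | inj₂ Mij   = inj₂ (x∈p-y⇒x≢y (proj₁ (inIJ i j Mij)) , x∈p-y⇒x≢y (proj₂ (inIJ i j Mij)) , Mij)

    arcs : ∀ i j → M⁺ i j ≡ true → i ∈ I × j ∈ J
    arcs i j h with new-or-old i j h
    ... | inj₁ refl = a∈I , b∈J
    ... | inj₂ (_ , _ , Mij) = x∈p-y⇒x∈p (proj₁ (inIJ i j Mij)) , x∈p-y⇒x∈p (proj₂ (inIJ i j Mij))

    Row : Fin N → Set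
    Row i = ∃[ j ] (M⁺ i j ≡ true × ∀ j′ → M⁺ i j′ ≡ true → j′ ≡ j)

    Col : Fin N → Set
    Col j = ∃[ i ] (M⁺ i j ≡ true × ∀ i′ → M⁺ i′ j ≡ true → i′ ≡ i)

    row : ∀ {i} → i ∈ I → Dec (i ≡ a) → Row i
    row _ (yes refl) = b , setArc-hit a b true M , unique
      where
      unique : ∀ j′ → M⁺ a j′ ≡ true → j′ ≡ b
      unique j′ h with new-or-old a j′ h
      ... | inj₁ refl = refl
      ... | inj₂ (a≢a , _) = contradiction refl a≢a
    row {i} i∈I (no i≢a) with matchI i (x∈p∧x≢y⇒x∈p-y i∈I i≢a)
    ... | j , Mij , uniqueM = j , trans (setArc-miss true M (i≢a ∘ cong proj₁)) Mij , unique
      where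
      unique : ∀ j′ → M⁺ i j′ ≡ true → j′ ≡ j
      unique j′ h with new-or-old i j′ h
      ... | inj₁ refl = contradiction refl i≢a
      ... | inj₂ (_ , _ , Mij′) = uniqueM j′ Mij′

    col : ∀ {j} → j ∈ J → Dec (j ≡ b) → Col j
    col _ (yes refl) = a , setArc-hit a b true M , unique
      where
      unique : ∀ i′ → M⁺ i′ b ≡ true → i′ ≡ a
      unique i′ h with new-or-old i′ b h
      ... | inj₁ refl = refl
      ... | inj₂ (_ , b≢b , _) = contradiction refl b≢b
    col {j} j∈J (no j≢b) with matchJ j (x∈p∧x≢y⇒x∈p-y j∈J j≢b)
    ... | i , Mij , uniqueM = i , trans (setArc-miss true M (j≢b ∘ cong proj₂)) Mij , unique
      where
      unique : ∀ i′ → M⁺ i′ j ≡ true → i′ ≡ i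
      unique i′ h with new-or-old i′ j h
      ... | inj₁ refl = contradiction refl j≢b
      ... | inj₂ (_ , _ , Mi′j) = uniqueM i′ Mi′j

    rows : ∀ i → i ∈ I → Row i
    rows i i∈I = row i∈I (i ≟ a)

    cols : ∀ j → j ∈ J → Col j
    cols j j∈J = col j∈J (j ≟ b)

  deleteArc-perfect : ∀ {I J M} {a b : Fin N} → IsPerfectMatching n I J M → M a b ≡ true →
                      IsPerfectMatching n (I - a) (J - b) (setArc a b false M)
  deleteArc-perfect {I} {J} {M} {a} {b} pm@(inIJ , matchI , matchJ) Mab = arcs , rows , cols
    where
    M⁻ = setArc a b false M

    avoids : ∀ {i j} → M i j ≡ true → (i , j) ≢ (a , b) → i ≢ a × j ≢ b
    avoids Mij ij≢ab = (λ { refl → ij≢ab (cong (a ,_) (perfectMatching-functional pm Mij Mab)) })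
                     , (λ { refl → ij≢ab (cong (_, b) (perfectMatching-injective pm Mij Mab)) })

    old : ∀ i j → M⁻ i j ≡ true → i ≢ a × j ≢ b × M i j ≡ true
    old i j h with setArc-false⇒ a b M i j h
    ... | ij≢ab , Mij = proj₁ (avoids Mij ij≢ab) , proj₂ (avoids Mij ij≢ab) , Mij

    arcs : ∀ i j → M⁻ i j ≡ true → i ∈ I - a × j ∈ J - b
    arcs i j h with old i j h
    ... | i≢a , j≢b , Mij = x∈p∧x≢y⇒x∈p-y (proj₁ (inIJ i j Mij)) i≢a , x∈p∧x≢y⇒x∈p-y (proj₂ (inIJ i j Mij)) j≢b

    rows : ∀ i → i ∈ I - a → ∃[ j ] (M⁻ i j ≡ true × ∀ j′ → M⁻ i j′ ≡ true → j′ ≡ j)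
    rows i i∈I-a with matchI i (x∈p-y⇒x∈p i∈I-a)
    ... | j , Mij , unique = j , trans (setArc-miss false M (x∈p-y⇒x≢y i∈I-a ∘ cong proj₁)) Mij
                           , λ j′ h → unique j′ (proj₂ (proj₂ (old i j′ h)))

    cols : ∀ j → j ∈ J - b → ∃[ i ] (M⁻ i j ≡ true × ∀ i′ → M⁻ i′ j ≡ true → i′ ≡ i)
    cols j j∈J-b with matchJ j (x∈p-y⇒x∈p j∈J-b)
    ... | i , Mij , unique = i , trans (setArc-miss false M (x∈p-y⇒x≢y j∈J-b ∘ cong proj₂)) Mij
                           , λ i′ h → unique i′ (proj₂ (proj₂ (old i′ j h)))

  insertArc-nonCrossing : ∀ {M} {a b : Fin N} → NonCrossing n M →
                          (∀ {i j} → M i j ≡ true → ¬ CyclicallyCross n a b i j) →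
                          NonCrossing n (setArc a b true M)
  insertArc-nonCrossing {M} {a} {b} nc avoidsAB i j i′ j′ h h′
    with setArc-true⇒ a b M i j h | setArc-true⇒ a b M i′ j′ h′
  ... | inj₁ refl | inj₁ refl = ¬CyclicallyCross-refl {a} {b}
  ... | inj₁ refl | inj₂ Mi′j′ = avoidsAB Mi′j′
  ... | inj₂ Mij  | inj₁ refl = avoidsAB Mij ∘ CyclicallyCross-sym {i} {j} {a} {b}
  ... | inj₂ Mij  | inj₂ Mi′j′ = nc i j i′ j′ Mij Mi′j′

  deleteArc-nonCrossing : ∀ {M} {a b : Fin N} → NonCrossing n M → NonCrossing n (setArc a b false M)
  deleteArc-nonCrossing {M} {a} {b} nc i j i′ j′ h h′ =
    nc i j i′ j′ (proj₂ (setArc-false⇒ a b M i j h)) (proj₂ (setArc-false⇒ a b M i′ j′ h′))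

  UniqueNonCrossingMatching : Subset N → Subset N → Set
  UniqueNonCrossingMatching I J =
    Σ (Arcs n) (λ M → IsPerfectMatching n I J M × NonCrossing n M
      × ((M′ : Arcs n) → IsPerfectMatching n I J M′ → NonCrossing n M′ → ∀ i j → M′ i j ≡ M i j))

  uniqueNonCrossingMatching : ∀ k {I J : Subset N} → ∣ I ∣ ≡ k → ∣ J ∣ ≡ k → UniqueNonCrossingMatching I J
  uniqueNonCrossingMatching zero {I} {J} ∣I∣≡0 ∣J∣≡0 =
    (λ _ _ → false) , ((λ _ _ ()) , (λ i i∈I → contradiction (i , i∈I) (∣p∣≡0⇒Empty ∣I∣≡0))
                                  , (λ j j∈J → contradiction (j , j∈J) (∣p∣≡0⇒Empty ∣J∣≡0)))
    , (λ _ _ _ _ ()) , noArcs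
    where
    noArcs : (M′ : Arcs n) → IsPerfectMatching n I J M′ → NonCrossing n M′ → ∀ i j → M′ i j ≡ false
    noArcs M′ (inIJ , _) _ i j with M′ i j in M′ij
    ... | true  = contradiction (i , proj₁ (inIJ i j M′ij)) (∣p∣≡0⇒Empty ∣I∣≡0)
    ... | false = refl
  uniqueNonCrossingMatching (suc k) {I} {J} ∣I∣≡1+k ∣J∣≡1+k
    with minimalArc I J (∣p∣≡suc⇒Nonempty ∣I∣≡1+k) (∣p∣≡suc⇒Nonempty ∣J∣≡1+k)
  ... | a , b , ab-minimal@(a∈I , b∈J , _)
    with uniqueNonCrossingMatching k (suc-injective (trans (x∈p⇒∣p-x∣+1≡∣p∣ a∈I) ∣I∣≡1+k))
                                     (suc-injective (trans (x∈p⇒∣p-x∣+1≡∣p∣ b∈J) ∣J∣≡1+k))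
  ... | M₀ , pm₀@(inIJ₀ , _) , nc₀ , unique₀ =
    setArc a b true M₀ , insertArc-perfect a∈I b∈J pm₀ , insertArc-nonCrossing nc₀ crossesNoArc , unique
    where
    crossesNoArc : ∀ {i j} → M₀ i j ≡ true → ¬ CyclicallyCross n a b i j
    crossesNoArc {i} {j} M₀ij =
      minimalArc-noCrossing ab-minimal (x∈p-y⇒x∈p (proj₁ (inIJ₀ i j M₀ij))) (x∈p-y⇒x∈p (proj₂ (inIJ₀ i j M₀ij)))

    unique : (M′ : Arcs n) → IsPerfectMatching n I J M′ → NonCrossing n M′ →
             ∀ i j → M′ i j ≡ setArc a b true M₀ i j
    unique M′ pm′ nc′ = setArc-unique M′ab λ ij≢ab → trans (sym (setArc-miss false M′ ij≢ab)) (M′⁻≡M₀ _ _)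
      where
      M′ab = minimalArc-matched ab-minimal pm′ nc′
      M′⁻≡M₀ = unique₀ (setArc a b false M′) (deleteArc-perfect pm′ M′ab) (deleteArc-nonCrossing nc′)

lemma6p7 : (n : ℕ) (I J : Subset (suc n)) → ∣ I ∣ ≡ ∣ J ∣ →
    Σ (Arcs n) (λ M → IsPerfectMatching n I J M × NonCrossing n M
      × ((M' : Arcs n) → IsPerfectMatching n I J M' → NonCrossing n M'
          → ∀ i j → M' i j ≡ M i j))
lemma6p7 n I J ∣I∣≡∣J∣ = uniqueNonCrossingMatching ∣ I ∣ refl (sym ∣I∣≡∣J∣)
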